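{- Let $D$ be a finite connected digraph with $\chi(D)=5$, not isomorphic to $T_5$, in which every vertex has out-degree at least $2$, such that $D$ contains no copy of $p_4$ and the underlying graph of $D$ contains no $K_5$. Let $v$ be a vertex of $D$ with out-degree at least $3$ and let $x,y,z$ be three distinct out-neighbors of $v$. If $x\to y$, then $x\to z$, $y$ and $z$ are not adjacent, and $N^-(y)=N^-(z)=\{v,x\}$.
   Context: A digraph has no loops and, for any two vertices $x,y$, at most one of the arcs $(x,y),(y,x)$; $\chi$ is the chromatic number of the underlying (unoriented) graph. $N^-(u)$ denotes the set of in-neighbors of $u$ in $D$. $T_5$ is the $5$-vertex tournament in which every vertex has in- and out-degree $2$. $p_4$ is the digraph with vertices $x,y,z,v,w$ and arcs $y\to x$, $y\to z$, $v\to z$, $v\to w$; a copy of $H$ in $D$ is the image of an injective arc-preserving map $V(H)\to V(D)$. -}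

module Defs where

open import Data.Nat using (ℕ; _≤_; _%_; _∸_; _+_; _≡ᵇ_)
open import Data.Bool using (Bool; true; false; _∨_)
open import Data.Fin using (Fin; toℕ) renaming (zero to f0; suc to fs)
open import Data.List using (length; filterᵇ; allFin)
open import Data.Sum using (_⊎_)
open import Data.Product using (Σ; _×_)
open import Relation.Nullary using (¬_)
open import Relation.Binary.PropositionalEquality using (_≡_; _≢_)
open import Function.Definitions using (Injective)
open import Function.Bundles using (_↔_; Inverse)

record Digraph : Set where
  field
    n        : ℕ
    arc      : Fin n → Fin n → Bool
    loopless : ∀ x → arc x x ≡ false
    asym     : ∀ x y → arc x y ≡ true → arc y x ≡ false
open Digraph public

module _ (D : Digraph) where

  _⇒_ : Fin (n D) → Fin (n D) → Set
  x ⇒ y = arc D x y ≡ true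

  Adj : Fin (n D) → Fin (n D) → Set
  Adj x y = x ⇒ y ⊎ y ⇒ x

  outdeg : Fin (n D) → ℕ
  outdeg x = length (filterᵇ (arc D x) (allFin (n D)))

  data Reach (x : Fin (n D)) : Fin (n D) → Set where
    here : Reach x x
    step : ∀ {y z} → Reach x y → Adj y z → Reach x z

  Connected : Set
  Connected = ∀ x y → Reach x y

  Colorable : ℕ → Set
  Colorable k = Σ (Fin (n D) → Fin k) λ c → ∀ x y → Adj x y → c x ≢ c y

  ChromaticNumber≡ : ℕ → Set
  ChromaticNumber≡ k = Colorable k × (∀ j → Colorable j → k ≤ j)

  -- a copy of p4 : vertices x=0,y=1,z=2,v=3,w=4, arcs y→x, y→z, v→z, v→w
  HasP4 : Set
  HasP4 = Σ (Fin 5 → Fin (n D)) λ f → Injective _≡_ _≡_ f ×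
            (f (fs f0) ⇒ f f0) × (f (fs f0) ⇒ f (fs (fs f0))) ×
            (f (fs (fs (fs f0))) ⇒ f (fs (fs f0))) ×
            (f (fs (fs (fs f0))) ⇒ f (fs (fs (fs (fs f0)))))

  HasK5 : Set
  HasK5 = Σ (Fin 5 → Fin (n D)) λ f → Injective _≡_ _≡_ f ×
            (∀ i j → i ≢ j → Adj (f i) (f j))

T5arc : Fin 5 → Fin 5 → Bool
T5arc i j = (d ≡ᵇ 1) ∨ (d ≡ᵇ 2)
  where d = (5 + toℕ j ∸ toℕ i) % 5

IsoT5 : Digraph → Set
IsoT5 D = Σ (Fin (n D) ↔ Fin 5) λ f →
            ∀ x y → arc D x y ≡ T5arc (Inverse.to f x) (Inverse.to f y)

-- Everything follows from out-degree at least 2 and the absence of p4: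
-- whenever one of the claims fails, some vertex can pick a second
-- out-neighbour completing a path  a ← b → c ← d → e  on five distinct
-- vertices.  Once x → z is established the configuration is symmetric in y
-- and z, so the remaining claims are proved once and applied twice.
module Submission where

open import Defs
open import Data.Nat using (_≥_; _≤_; s≤s)
open import Data.Fin using (Fin; _≟_)
open import Data.Sum using (_⊎_; inj₁; inj₂; [_,_])
open import Data.Product using (_×_; ∃-syntax; _,_; proj₂)
open import Data.Bool using (T; T?)
open import Data.Bool.Properties using (T-≡)
open import Data.List using (List; []; _∷_; length; allFin)
open import Data.List.Membership.Propositional using (_∈_)
open import Data.List.Membership.Propositional.Properties using (∈-filter⁻)
open import Data.List.Relation.Unary.Any using (here; there)
open import Data.List.Relation.Unary.All using (_∷_)
open import Data.List.Relation.Unary.AllPairs using (_∷_)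
import Data.List.Relation.Unary.Unique.Propositional as List
open import Data.List.Relation.Unary.Unique.Propositional.Properties using (filter⁺; allFin⁺)
open import Data.Vec using (Vec; []; _∷_; lookup)
import Data.Vec.Relation.Unary.All as Vec
import Data.Vec.Relation.Unary.AllPairs as Vec
open import Data.Vec.Relation.Unary.Unique.Propositional using () renaming (Unique to UniqueVec)
open import Data.Vec.Relation.Unary.Unique.Propositional.Properties using (lookup-injective)
open import Relation.Nullary using (¬_; Dec; yes; no)
open import Data.Empty using (⊥; ⊥-elim)
open import Relation.Binary.Definitions using (DecidableEquality)
open import Relation.Binary.PropositionalEquality using (_≡_; _≢_; refl; sym; trans; ≢-sym)
open import Function.Bundles using (_⇔_; mk⇔; Equivalence)

Unique∧length≥2⇒∈-avoiding : ∀ {A : Set} → DecidableEquality A →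
                             ∀ {xs : List A} → List.Unique xs → 2 ≤ length xs →
                             (y : A) → ∃[ c ] c ∈ xs × c ≢ y
Unique∧length≥2⇒∈-avoiding _ {[]} _ () _
Unique∧length≥2⇒∈-avoiding _ {_ ∷ []} _ (s≤s ()) _
Unique∧length≥2⇒∈-avoiding _≟ᴬ_ {a ∷ b ∷ _} ((a≢b ∷ _) ∷ _) _ y with a ≟ᴬ y
... | no  a≢y  = a , here refl , a≢y
... | yes refl = b , there (here refl) , ≢-sym a≢b

module _ (D : Digraph) where

  private
    V : Set
    V = Fin (n D)

    _⇒′_ : V → V → Set
    _⇒′_ = _⇒_ D

  outdeg≥2⇒other-out-neighbour : ∀ {u} → outdeg D u ≥ 2 → (y : V) → ∃[ c ] u ⇒′ c × c ≢ y
  outdeg≥2⇒other-out-neighbour {u} od y =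
    let c , c∈ , c≢y = Unique∧length≥2⇒∈-avoiding _≟_ (filter⁺ u⇒? (allFin⁺ (n D))) od y
    in  c , Equivalence.to T-≡ (proj₂ (∈-filter⁻ u⇒? {xs = allFin (n D)} c∈)) , c≢y
    where
    u⇒? : ∀ w → Dec (T (arc D u w))
    u⇒? w = T? (arc D u w)

  ⇒⇒≢ : ∀ {u w} → u ⇒′ w → u ≢ w
  ⇒⇒≢ {u} u⇒u refl with trans (sym u⇒u) (loopless D u)
  ... | ()

  ⇒-⇒⇒≢ : ∀ {u w t} → u ⇒′ w → w ⇒′ t → u ≢ t
  ⇒-⇒⇒≢ {u} {w} u⇒w w⇒u refl with trans (sym (asym D u w u⇒w)) w⇒u
  ... | ()

  -- The four distinctions between consecutive vertices of the path come from looplessness.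
  p4-path⇒HasP4 : ∀ {a b c d e} → b ⇒′ a → b ⇒′ c → d ⇒′ c → d ⇒′ e →
                  a ≢ c → a ≢ d → a ≢ e → b ≢ d → b ≢ e → c ≢ e → HasP4 D
  p4-path⇒HasP4 {a} {b} {c} {d} {e} b⇒a b⇒c d⇒c d⇒e a≢c a≢d a≢e b≢d b≢e c≢e =
    lookup path , lookup-injective distinct _ _ , b⇒a , b⇒c , d⇒c , d⇒e
    where
    path : Vec V 5
    path = a ∷ b ∷ c ∷ d ∷ e ∷ []
    distinct : UniqueVec path
    distinct = (≢-sym (⇒⇒≢ b⇒a) Vec.∷ a≢c Vec.∷ a≢d Vec.∷ a≢e Vec.∷ Vec.[])
         Vec.∷ (⇒⇒≢ b⇒c Vec.∷ b≢d Vec.∷ b≢e Vec.∷ Vec.[])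
         Vec.∷ (≢-sym (⇒⇒≢ d⇒c) Vec.∷ c≢e Vec.∷ Vec.[])
         Vec.∷ (⇒⇒≢ d⇒e Vec.∷ Vec.[])
         Vec.∷ Vec.[] Vec.∷ Vec.[]

  module _ (outdeg≥2 : ∀ u → outdeg D u ≥ 2) (¬p4 : ¬ HasP4 D)
           {v x y z : V} (v⇒x : v ⇒′ x) (v⇒y : v ⇒′ y) (v⇒z : v ⇒′ z)
           (x≢y : x ≢ y) (x≢z : x ≢ z) (y≢z : y ≢ z) (x⇒y : x ⇒′ y) where

    ⇒-extends : x ⇒′ z
    ⇒-extends with outdeg≥2⇒other-out-neighbour (outdeg≥2 x) y
    ... | b , x⇒b , b≢y with b ≟ z
    ... | yes refl = x⇒b
    ... | no  b≢z  = ⊥-elim (¬p4 (p4-path⇒HasP4 v⇒z v⇒y x⇒y x⇒b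
            (≢-sym y≢z) (≢-sym x≢z) (≢-sym b≢z) (⇒⇒≢ v⇒x) (⇒-⇒⇒≢ v⇒x x⇒b) (≢-sym b≢y)))

    ¬⇒-from-dominated : ¬ y ⇒′ z
    ¬⇒-from-dominated y⇒z with outdeg≥2⇒other-out-neighbour (outdeg≥2 y) z
    ... | c , y⇒c , c≢z = ¬p4 (p4-path⇒HasP4 y⇒c y⇒z v⇒z v⇒x
            c≢z (≢-sym (⇒-⇒⇒≢ v⇒y y⇒c)) (≢-sym (⇒-⇒⇒≢ x⇒y y⇒c))
            (≢-sym (⇒⇒≢ v⇒y)) (≢-sym x≢y) (≢-sym x≢z))

    module _ (x⇒z : x ⇒′ z) (¬z⇒y : ¬ z ⇒′ y) where

      private
        z≢in-neighbour : ∀ {u} → u ⇒′ y → z ≢ u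
        z≢in-neighbour u⇒y refl = ¬z⇒y u⇒y

      in-neighbour-of-dominated : ∀ {u} → u ⇒′ y → u ≢ v → u ≢ x → ⊥
      in-neighbour-of-dominated {u} u⇒y u≢v u≢x
        with outdeg≥2⇒other-out-neighbour (outdeg≥2 u) y
      ... | c , u⇒c , c≢y with c ≟ z | c ≟ x
      ... | yes refl | _        = ¬p4 (p4-path⇒HasP4 v⇒x v⇒y u⇒y u⇒c
              x≢y (≢-sym u≢x) x≢z (≢-sym u≢v) (⇒⇒≢ v⇒z) y≢z)
      ... | no _     | yes refl = ¬p4 (p4-path⇒HasP4 v⇒z v⇒y u⇒y u⇒c
              (≢-sym y≢z) (z≢in-neighbour u⇒y) (≢-sym x≢z) (≢-sym u≢v) (⇒⇒≢ v⇒x) (≢-sym x≢y))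
      ... | no c≢z   | no c≢x   = ¬p4 (p4-path⇒HasP4 x⇒z x⇒y u⇒y u⇒c
              (≢-sym y≢z) (z≢in-neighbour u⇒y) (≢-sym c≢z) (≢-sym u≢x) (≢-sym c≢x) (≢-sym c≢y))

      in-neighbours-of-dominated : ∀ u → u ⇒′ y ⇔ (u ≡ v ⊎ u ≡ x)
      in-neighbours-of-dominated u = mk⇔ to from
        where
        to : u ⇒′ y → u ≡ v ⊎ u ≡ x
        to u⇒y with u ≟ v | u ≟ x
        ... | yes u≡v | _       = inj₁ u≡v
        ... | no _    | yes u≡x = inj₂ u≡x
        ... | no u≢v  | no u≢x  = ⊥-elim (in-neighbour-of-dominated u⇒y u≢v u≢x)
        from : u ≡ v ⊎ u ≡ x → u ⇒′ y
        from (inj₁ refl) = v⇒y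
        from (inj₂ refl) = x⇒y

lemma2p10 : (D : Digraph) → Connected D → ChromaticNumber≡ D 5 → ¬ IsoT5 D →
    (∀ u → outdeg D u ≥ 2) → ¬ HasP4 D → ¬ HasK5 D →
    (v x y z : Fin (n D)) → outdeg D v ≥ 3 →
    _⇒_ D v x → _⇒_ D v y → _⇒_ D v z → x ≢ y → x ≢ z → y ≢ z →
    _⇒_ D x y →
    _⇒_ D x z × ¬ Adj D y z ×
    (∀ u → (_⇒_ D u y ⇔ (u ≡ v ⊎ u ≡ x))) ×
    (∀ u → (_⇒_ D u z ⇔ (u ≡ v ⊎ u ≡ x)))
lemma2p10 D _ _ _ outdeg≥2 ¬p4 _ v x y z _ v⇒x v⇒y v⇒z x≢y x≢z y≢z x⇒y =
  x⇒z , [ ¬y⇒z , ¬z⇒y ] ,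
  in-neighbours-of-dominated D outdeg≥2 ¬p4 v⇒x v⇒y v⇒z x≢y x≢z y≢z x⇒y x⇒z ¬z⇒y ,
  in-neighbours-of-dominated D outdeg≥2 ¬p4 v⇒x v⇒z v⇒y x≢z x≢y (≢-sym y≢z) x⇒z x⇒y ¬y⇒z
  where
  x⇒z : _⇒_ D x z
  x⇒z = ⇒-extends D outdeg≥2 ¬p4 v⇒x v⇒y v⇒z x≢y x≢z y≢z x⇒y
  ¬y⇒z : ¬ _⇒_ D y z
  ¬y⇒z = ¬⇒-from-dominated D outdeg≥2 ¬p4 v⇒x v⇒y v⇒z x≢y x≢z y≢z x⇒y
  ¬z⇒y : ¬ _⇒_ D z y
  ¬z⇒y = ¬⇒-from-dominated D outdeg≥2 ¬p4 v⇒x v⇒z v⇒y x≢z x≢y (≢-sym y≢z) x⇒z
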